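{- Let $\mathcal{D}$ be the arena of a playable $p$-periodic temporal graph $\mathcal{G}$, and let $\mathcal{A}^*$ be the maximum augmented arena of $\mathcal{D}$. Then $\mathcal{D}$ is copwin if and only if $\mathcal{A}^*$ contains an anchored star, i.e. a temporal node $(t,u)$ with $\Gamma_t(u,\mathcal{A}^*)=V$ which is anchored.
   Context: Let $V$ be a finite set of $n$ vertices and $p\ge 1$ an integer. A $p$-periodic temporal graph $\mathcal{G}=(G_0,\dots,G_{p-1})^*$ is the infinite sequence of directed graphs whose snapshot at time $t\in\{0,1,2,\dots\}$ is $G_{t\bmod p}=(V,E_{t\bmod p})$, where each $E_i\subseteq V\times V$ may contain self-loops. It is playable if in every $G_i$ every vertex has at least one outgoing edge; no other assumption (connectivity, symmetry, reflexivity) is made. Slice indices are taken modulo $p$. An arena of length $p$ on $V$ is a directed graph with vertex set $\mathbb{Z}_p\times V$ (temporal nodes) all of whose edges have the form $((i,w),(i+1 \bmod p,w'))$. The arena of $\mathcal{G}$ is the arena $\mathcal{D}$ with $((i,u),(i+1,v))\in E(\mathcal{D})$ iff $(u,v)\in E_i$. For an arena $\mathcal{A}$ write $\Gamma_t(u,\mathcal{A})=\{v\in V:((t,u),(t+1,v))\in E(\mathcal{A})\}$. Game (one cop, one robber, restless, full information): first the cop chooses a starting vertex, then the robber. In each round $t$, first the cop moves from its vertex $c$ to some $c'\in\Gamma_{t\bmod p}(c,\mathcal{D})$, then the robber moves from its vertex $r$ to some $r'\in\Gamma_{t\bmod p}(r,\mathcal{D})$. The cop wins if it moves onto the vertex currently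 occupied by the robber (both on the same vertex counts as capture); the robber wins by avoiding capture forever. A configuration $(t,c,r)$ (cop at $c$, robber at $r$ at the start of round $t$, cop to move) is copwin if the cop has a strategy guaranteeing capture from it; this depends only on $t\bmod p$. $\mathcal{D}$ is copwin if there is $c\in V$ with $(0,c,r)$ copwin for all $r\in V$. An augmented arena of $\mathcal{D}$ is an arena $\mathcal{A}$ with $E(\mathcal{D})\subseteq E(\mathcal{A})$ such that for every edge $((t,x),(t+1,y))\in E(\mathcal{A})$ the configuration $(t,x,y)$ is copwin. The augmented arenas are closed under union of edge sets; $\mathcal{A}^*$ denotes the one with the largest edge set. A temporal node $(t,u)$ is anchored if there is a directed walk in $\mathcal{D}$ (possibly of length zero) from some temporal node $(0,v)$ to $(t,u)$. -}

module Defs where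

open import Data.Nat using (ℕ; zero; suc)
open import Data.Nat.DivMod using (_mod_)
open import Data.Fin using (Fin; toℕ)
open import Data.Bool using (Bool; true)
open import Data.Product using (Σ; ∃; _×_)
open import Data.Sum using (_⊎_)
open import Relation.Binary.PropositionalEquality using (_≡_)

-- Period p = suc q (so p ≥ 1); slice indices / arena times are Fin p = ℤ_p.
-- Vertex set V = Fin n.

next : {q : ℕ} → Fin (suc q) → Fin (suc q)
next {q} i = suc (toℕ i) mod (suc q)

-- A p-periodic temporal graph (G_0,…,G_{p-1})* on Fin n:
-- E i u v ≡ true  iff  (u,v) ∈ E_i  (self-loops allowed).
TemporalGraph : ℕ → ℕ → Set
TemporalGraph q n = Fin (suc q) → Fin n → Fin n → Bool

Playable : {q n : ℕ} → TemporalGraph q n → Set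
Playable {q} {n} E = ∀ (i : Fin (suc q)) (u : Fin n) → ∃ λ v → E i u v ≡ true

-- An arena of length p on Fin n: Arena A t x y  means the edge
-- ((t,x),(t+1 mod p,y)) is present; so Γ_t(x,A) = { y | A t x y }.
Arena : ℕ → ℕ → Set₁
Arena q n = Fin (suc q) → Fin n → Fin n → Set

arenaOf : {q n : ℕ} → TemporalGraph q n → Arena q n
arenaOf E t u v = E t u v ≡ true

-- Copwin configurations of the game played on arena D (restless moves,
-- cop moves first each round).  CopWin D t c r : from configuration
-- (t,c,r) (cop to move at round t mod p) the cop can force capture.
-- Inductive (least fixed point), i.e. capture after finitely many rounds.
data CopWin {q n : ℕ} (D : Arena q n) : Fin (suc q) → Fin n → Fin n → Set where
  caught : ∀ {t c} → CopWin D t c c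
  move   : ∀ {t c r} (c' : Fin n) → D t c c' →
           (c' ≡ r ⊎ (∀ (r' : Fin n) → D t r r' → CopWin D (next t) c' r')) →
           CopWin D t c r

IsCopwin : {q n : ℕ} → Arena q n → Set
IsCopwin {q} {n} D = ∃ λ (c : Fin n) → ∀ (r : Fin n) → CopWin D Data.Fin.zero c r

_⊆A_ : {q n : ℕ} → Arena q n → Arena q n → Set
_⊆A_ {q} {n} A B = ∀ (t : Fin (suc q)) (x y : Fin n) → A t x y → B t x y

IsAugmented : {q n : ℕ} → Arena q n → Arena q n → Set
IsAugmented {q} {n} D A =
  (D ⊆A A) × (∀ (t : Fin (suc q)) (x y : Fin n) → A t x y → CopWin D t x y)

IsMaxAugmented : {q n : ℕ} → Arena q n → Arena q n → Set₁
IsMaxAugmented D A = IsAugmented D A × (∀ B → IsAugmented D B → B ⊆A A)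

data Anchored {q n : ℕ} (D : Arena q n) : Fin (suc q) → Fin n → Set where
  start : ∀ (v : Fin n) → Anchored D Data.Fin.zero v
  step  : ∀ {t u u'} → Anchored D t u → D t u u' → Anchored D (next t) u'

IsStar : {q n : ℕ} → Arena q n → Fin (suc q) → Fin n → Set
IsStar {q} {n} A t u = ∀ (v : Fin n) → A t u v

HasAnchoredStar : {q n : ℕ} → Arena q n → Arena q n → Set
HasAnchoredStar {q} {n} D A =
  Σ (Fin (suc q)) λ t → Σ (Fin n) λ u → IsStar A t u × Anchored D t u

module Submission where

open import Defs
open import Data.Nat using (ℕ; suc)
open import Data.Fin using (Fin; zero)
open import Data.Product using (_×_; _,_)
open import Data.Sum using (inj₁; inj₂)
open import Relation.Binary.PropositionalEquality using (refl)

-- The maximum augmented arena is exactly the relation "(t,x,y) is copwin", so its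
-- stars are the temporal nodes from which the cop wins against every robber.
-- A copwin start is an anchored star at time 0; conversely, the cop can walk
-- along the anchoring walk from time 0 to a star, whatever the robber does.

module _ {q n : ℕ} (D : Arena q n) where

  edge⇒copWin : D ⊆A CopWin D
  edge⇒copWin t x y e = move y e (inj₁ refl)

  copWin-augmented : IsAugmented D (CopWin D)
  copWin-augmented = edge⇒copWin , λ t x y w → w

  maxAugmented-complete : {A : Arena q n} → IsMaxAugmented D A → CopWin D ⊆A A
  maxAugmented-complete (_ , maximal) = maximal (CopWin D) copWin-augmented

  maxAugmented-sound : {A : Arena q n} → IsMaxAugmented D A → A ⊆A CopWin D
  maxAugmented-sound ((_ , sound) , _) = sound

  winningStart : Fin (suc q) → Fin n → Set
  winningStart t c = ∀ r → CopWin D t c r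

  winningStart-pred : ∀ {t c c'} → D t c c' → winningStart (next t) c' → winningStart t c
  winningStart-pred {c' = c'} e win r = move c' e (inj₂ λ r' _ → win r')

  anchored-winningStart⇒copwin : ∀ {t c} → Anchored D t c → winningStart t c → IsCopwin D
  anchored-winningStart⇒copwin (start c)  win = c , win
  anchored-winningStart⇒copwin (step a e) win =
    anchored-winningStart⇒copwin a (winningStart-pred e win)

theorem1 : (q n : ℕ) (E : TemporalGraph q n) → Playable E →
    (A : Arena q n) → IsMaxAugmented (arenaOf E) A →
    (IsCopwin (arenaOf E) → HasAnchoredStar (arenaOf E) A) ×
    (HasAnchoredStar (arenaOf E) A → IsCopwin (arenaOf E))
theorem1 q n E _ A max = copwin⇒star , star⇒copwin
  where
  D = arenaOf E

  copwin⇒star : IsCopwin D → HasAnchoredStar D A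
  copwin⇒star (c , win) =
    zero , c , (λ r → maxAugmented-complete D max zero c r (win r)) , start c

  star⇒copwin : HasAnchoredStar D A → IsCopwin D
  star⇒copwin (t , u , star , anchored) =
    anchored-winningStart⇒copwin D anchored
      (λ r → maxAugmented-sound D max t u r (star r))
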